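{- Let $p$ be a prime and $1\le\beta\le(p-3)/2$; let $\beta^*$ be the unique integer with $1\le\beta^*\le p-1$ and $\beta\beta^*\equiv1\pmod p$. Let $q>p$ be a prime with $q\equiv\beta\pmod p$, let $r>q$ be a prime with $qr\equiv-1\pmod p$, and let $\rho,\sigma\ge0$ be the unique integers with $(p-1)(q-1)=\rho p+\sigma q$. Suppose $\beta+\sigma\ge p-1$. Let $\mathcal{I}$ be the set of real numbers $\alpha$ satisfying all of $$\alpha<\frac{(\sigma+1)q-1}{p(\beta-1)},\quad \alpha\le\frac{q(p-\sigma-1)}{p(p-\beta)},\quad \alpha\le\frac{q(\sigma+1-\beta)}{p(\sigma+1)},\quad \alpha>\frac{q(p-2\beta-1)}{p(p-\beta-1)}.$$ Put $\gamma=\min\Big\{\frac{p-\beta^*}{p-\beta},\frac{\beta^*-\beta}{\beta^*}\Big\}$. Then $\mathcal{I}$ is non-empty if and only if $\beta^*\le2\beta$, and in that case $$\mathcal{I}=\Big(\frac{q(p-1-2\beta)}{p(p-1-\beta)},\ \frac{q\gamma}{p}\Big].$$ If $\mathcal{I}$ is non-empty, it consists of positive reals only.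
   Formalization: The numbers α forming the set $\mathcal{I}$ are taken over the rationals instead of the reals. -}

module Defs where

open import Data.Nat as ℕ using (ℕ; zero; suc)
open import Data.Integer as ℤ using (ℤ; +_; -[1+_])
open import Data.Rational as ℚ using (ℚ; _/_; 0ℚ; _⊓_)
open import Data.Product using (_×_)

-- frac n d = n / d as a rational number, for any nonzero integer d.
-- (Convention frac n 0 = 0 is never used: all denominators below are
--  nonzero under the hypotheses of lemma6.)
frac : ℤ → ℤ → ℚ
frac n (+ zero)    = 0ℚ
frac n (+ (suc d)) = n / suc d
frac n -[1+ d ]    = (ℤ.- n) / suc d

-- The first condition  α < ((σ+1)q-1) / (p(β-1))  is stated with the
-- denominator cleared:  p(β-1)·α < (σ+1)q-1  (for β = 1 this makes the
-- condition vacuous, i.e. the bound is +∞).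
InI : ℕ → ℕ → ℕ → ℕ → ℚ → Set
InI p β q σ α =
    (frac (+ p ℤ.* (+ β ℤ.- + 1)) (+ 1) ℚ.* α
        ℚ.< frac ((+ σ ℤ.+ + 1) ℤ.* + q ℤ.- + 1) (+ 1))
  × (α ℚ.≤ frac (+ q ℤ.* (+ p ℤ.- + σ ℤ.- + 1)) (+ p ℤ.* (+ p ℤ.- + β)))
  × (α ℚ.≤ frac (+ q ℤ.* (+ σ ℤ.+ + 1 ℤ.- + β)) (+ p ℤ.* (+ σ ℤ.+ + 1)))
  × (frac (+ q ℤ.* (+ p ℤ.- + 2 ℤ.* + β ℤ.- + 1)) (+ p ℤ.* (+ p ℤ.- + β ℤ.- + 1)) ℚ.< α)

γ : ℕ → ℕ → ℕ → ℚ
γ p β βs = frac (+ p ℤ.- + βs) (+ p ℤ.- + β) ⊓ frac (+ βs ℤ.- + β) (+ βs)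

lowI : ℕ → ℕ → ℕ → ℚ
lowI p β q = frac (+ q ℤ.* (+ p ℤ.- + 1 ℤ.- + 2 ℤ.* + β)) (+ p ℤ.* (+ p ℤ.- + 1 ℤ.- + β))

highI : ℕ → ℕ → ℕ → ℕ → ℚ
highI p β βs q = frac (+ q) (+ p) ℚ.* γ p β βs

-- Modulo p, (p−1)(q−1) = ρp + σq gives (σ+1)q ≡ 1, and q ≡ β, so σ+1 and β* are both
-- inverses of β in [1, p−1]; hence β* = σ+1. Factoring out q/p, the second and third
-- constraints say α ≤ (q/p)γ, the fourth says α > (q/p)λ₀ with λ₀ = (p−1−2β)/(p−1−β) ≥ 0,
-- and the first is implied by the third. So 𝓘 = ((q/p)λ₀, (q/p)γ], which is non-empty iff
-- λ₀ < γ. Cross-multiplying, λ₀ < (β*−β)/β* always holds because β + σ ≥ p − 1, while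
-- λ₀ < (p−β*)/(p−β) holds iff β* ≤ 2β.
module Submission where

open import Defs
open import Data.Nat using (ℕ; _+_; _*_; _∸_; _≤_; _<_)
open import Data.Nat.Primality using (Prime)
open import Data.Nat.Divisibility using (_∣_)
open import Data.Rational using (ℚ; 0ℚ) renaming (_<_ to _<ℚ_; _≤_ to _≤ℚ_)
open import Data.Product using (_×_; ∃)
open import Function.Bundles using (_⇔_)
open import Relation.Binary.PropositionalEquality using (_≡_)

open import Data.Nat as ℕ using (suc; zero; z≤n; s≤s; NonZero; _≤?_)
import Data.Nat.Properties as ℕP
open import Data.Nat.DivMod using (_%_; m<n⇒m%n≡m; [m+kn]%n≡m%n; %-distribˡ-*; %-remove-+ʳ)
import Data.Nat.Tactic.RingSolver as ℕ-Solver
open import Data.Integer as ℤ using (ℤ; +_; 0ℤ; +<+; +≤+)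
import Data.Integer.Properties as ℤP
import Data.Integer.Tactic.RingSolver as ℤ-Solver
open import Data.Rational as ℚ using (_⊓_)
import Data.Rational.Properties as ℚP
import Data.Rational.Unnormalised as ℚᵘ
import Data.Rational.Unnormalised.Properties as ℚᵘP
open import Data.Product using (_,_; proj₁)
open import Data.Sum using (inj₁; inj₂)
open import Function.Base using (case_of_)
open import Function.Bundles using (mk⇔; Equivalence)
import Function.Properties.Equivalence
open import Relation.Nullary using (yes; no; contradiction)
open import Relation.Binary.PropositionalEquality
  using (refl; sym; trans; cong; cong₂; subst; module ≡-Reasoning)

≤∸⇒+≤ : ∀ {m n o} → 0 < m → m ≤ o ∸ n → n + m ≤ o
≤∸⇒+≤ {m} {n} {o} 0<m m≤o∸n = subst (_≤ o) (ℕP.+-comm m n) (ℕP.m≤o∸n⇒m+n≤o m n≤o m≤o∸n)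
  where
  n≤o : n ≤ o
  n≤o = ℕP.<⇒≤ (ℕP.m∸n≢0⇒n<m (ℕP.n>0⇒n≢0 (ℕP.≤-trans 0<m m≤o∸n)))

∣∸⇒%≡ : ∀ {p a b} .{{_ : NonZero p}} → b ≤ a → p ∣ a ∸ b → a % p ≡ b % p
∣∸⇒%≡ {p} {a} {b} b≤a p∣a∸b = begin
  a % p             ≡⟨ cong (_% p) (ℕP.m+[n∸m]≡n b≤a) ⟨
  (b + (a ∸ b)) % p ≡⟨ %-remove-+ʳ b p∣a∸b ⟩
  b % p             ∎
  where open ≡-Reasoning

*-congˡ-% : ∀ {p a b} c .{{_ : NonZero p}} → a % p ≡ b % p → (c * a) % p ≡ (c * b) % p
*-congˡ-% {p} {a} {b} c a≡b = begin
  (c * a) % p             ≡⟨ %-distribˡ-* c a p ⟩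
  ((c % p) * (a % p)) % p ≡⟨ cong (λ x → ((c % p) * x) % p) a≡b ⟩
  ((c % p) * (b % p)) % p ≡⟨ %-distribˡ-* c b p ⟨
  (c * b) % p             ∎
  where open ≡-Reasoning

%-inverse-unique : ∀ {p a b c} .{{_ : NonZero p}} → b < p → c < p →
                   (a * b) % p ≡ 1 % p → (a * c) % p ≡ 1 % p → b ≡ c
%-inverse-unique {p} {a} {b} {c} b<p c<p ab≡1 ac≡1 = begin
  b                   ≡⟨ m<n⇒m%n≡m b<p ⟨
  b % p               ≡⟨ cong (_% p) (ℕP.*-identityʳ b) ⟨
  (b * 1) % p         ≡⟨ *-congˡ-% b ac≡1 ⟨
  (b * (a * c)) % p   ≡⟨ cong (_% p) (swap b a c) ⟩
  (c * (a * b)) % p   ≡⟨ *-congˡ-% c ab≡1 ⟩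
  (c * 1) % p         ≡⟨ cong (_% p) (ℕP.*-identityʳ c) ⟩
  c % p               ≡⟨ m<n⇒m%n≡m c<p ⟩
  c                   ∎
  where
  open ≡-Reasoning
  swap : ∀ x y z → x * (y * z) ≡ z * (y * x)
  swap = ℕ-Solver.solve-∀

suc-σ≡βs : ∀ {p β βs q ρ σ} .{{_ : NonZero p}} → 1 ≤ β → 1 ≤ βs → βs < p → β ≤ q →
           p ∣ β * βs ∸ 1 → p ∣ q ∸ β → (p ∸ 1) * (q ∸ 1) ≡ ρ * p + σ * q → suc σ ≡ βs
suc-σ≡βs {q = zero} 1≤β _ _ β≤0 _ _ _ = contradiction (ℕP.≤-trans 1≤β β≤0) λ ()
suc-σ≡βs {suc p'} {β} {βs} {suc q'} {ρ} {σ} 1≤β 1≤βs βs<p β≤q p∣ββs∸1 p∣q∸β decomposition =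
  %-inverse-unique {a = q} suc-σ<p βs<p q*suc-σ≡1 q*βs≡1
  where
  p = suc p'
  q = suc q'
  q*suc-σ≡1 : (q * suc σ) % p ≡ 1 % p
  q*suc-σ≡1 = begin
    (q * suc σ) % p           ≡⟨ [m+kn]%n≡m%n (q * suc σ) ρ p ⟨
    (q * suc σ + ρ * p) % p   ≡⟨ cong (_% p) (regroup q σ ρ p) ⟩
    (q + (ρ * p + σ * q)) % p ≡⟨ cong (λ x → (q + x) % p) decomposition ⟨
    (q + p' * q') % p         ≡⟨ cong (_% p) (regroup′ p' q') ⟩
    (1 + q' * p) % p          ≡⟨ [m+kn]%n≡m%n 1 q' p ⟩
    1 % p                     ∎
    where
    open ≡-Reasoning
    regroup : ∀ q σ ρ p → q * suc σ + ρ * p ≡ q + (ρ * p + σ * q)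
    regroup = ℕ-Solver.solve-∀
    regroup′ : ∀ p' q' → suc q' + p' * q' ≡ 1 + q' * suc p'
    regroup′ = ℕ-Solver.solve-∀
  q*βs≡1 : (q * βs) % p ≡ 1 % p
  q*βs≡1 = begin
    (q * βs) % p  ≡⟨ cong (_% p) (ℕP.*-comm q βs) ⟩
    (βs * q) % p  ≡⟨ *-congˡ-% βs (∣∸⇒%≡ β≤q p∣q∸β) ⟩
    (βs * β) % p  ≡⟨ cong (_% p) (ℕP.*-comm βs β) ⟩
    (β * βs) % p  ≡⟨ ∣∸⇒%≡ (ℕP.*-mono-≤ 1≤β 1≤βs) p∣ββs∸1 ⟩
    1 % p         ∎
    where open ≡-Reasoning
  suc-σ<p : suc σ < p
  suc-σ<p = s≤s (ℕP.*-cancelʳ-< q σ p' (begin-strict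
    σ * q         ≤⟨ ℕP.m≤n+m (σ * q) (ρ * p) ⟩
    ρ * p + σ * q ≡⟨ decomposition ⟨
    p' * q'       <⟨ ℕP.*-monoʳ-< p' {{ℕ.>-nonZero 0<p'}} (ℕP.n<1+n q') ⟩
    p' * q        ∎))
    where
    open ℕP.≤-Reasoning
    0<p' : 0 < p'
    0<p' = ℕP.≤-trans 1≤βs (ℕ.s≤s⁻¹ βs<p)

0≤+n-+m : ∀ {m n} → m ≤ n → 0ℤ ℤ.≤ + n ℤ.- + m
0≤+n-+m m≤n = ℤP.i≤j⇒0≤j-i (+≤+ m≤n)

0<+n-+m : ∀ {m n} → m < n → 0ℤ ℤ.< + n ℤ.- + m
0<+n-+m {m} {n} m<n rewrite ℤP.m-n≡m⊖n n m | ℤP.⊖-≥ (ℕP.<⇒≤ m<n) = +<+ (ℕP.m<n⇒0<n∸m m<n)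

nonNeg*nonNeg : ∀ {i j} → 0ℤ ℤ.≤ i → 0ℤ ℤ.≤ j → 0ℤ ℤ.≤ i ℤ.* j
nonNeg*nonNeg {i} {j} 0≤i 0≤j =
  subst (ℤ._≤ i ℤ.* j) (ℤP.*-zeroʳ i) (ℤP.*-monoˡ-≤-nonNeg i {{ℤ.nonNegative 0≤i}} 0≤j)

pos*pos : ∀ {i j} → 0ℤ ℤ.< i → 0ℤ ℤ.< j → 0ℤ ℤ.< i ℤ.* j
pos*pos {i} {j} 0<i 0<j =
  subst (ℤ._< i ℤ.* j) (ℤP.*-zeroʳ i) (ℤP.*-monoˡ-<-pos i {{ℤ.positive 0<i}} 0<j)

nonNeg+nonNeg : ∀ {i j} → 0ℤ ℤ.≤ i → 0ℤ ℤ.≤ j → 0ℤ ℤ.≤ i ℤ.+ j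
nonNeg+nonNeg = ℤP.+-mono-≤

nonNeg+pos : ∀ {i j} → 0ℤ ℤ.≤ i → 0ℤ ℤ.< j → 0ℤ ℤ.< i ℤ.+ j
nonNeg+pos = ℤP.+-mono-≤-<

≤-from-gap : ∀ {i j} d → j ≡ i ℤ.+ d → 0ℤ ℤ.≤ d → i ℤ.≤ j
≤-from-gap {i} d refl 0≤d = ℤP.i≤i+j i d {{ℤ.nonNegative 0≤d}}

<-from-gap : ∀ {i j} d → j ≡ i ℤ.+ d → 0ℤ ℤ.< d → i ℤ.< j
<-from-gap {i} d refl 0<d = subst (ℤ._< i ℤ.+ d) (ℤP.+-identityʳ i) (ℤP.+-monoʳ-< i 0<d)

toℚᵘ-frac : ∀ n d → ℚ.toℚᵘ (frac n (+ suc d)) ℚᵘ.≃ ℚᵘ.mkℚᵘ n d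
toℚᵘ-frac n d = ℚP.toℚᵘ-fromℚᵘ (ℚᵘ.mkℚᵘ n d)

frac≤frac : ∀ n m {D E} → 0ℤ ℤ.< D → 0ℤ ℤ.< E →
            n ℤ.* E ℤ.≤ m ℤ.* D → frac n D ≤ℚ frac m E
frac≤frac n m {+ zero} (+<+ ()) _ _
frac≤frac n m {+ suc _} {+ zero} _ (+<+ ()) _
frac≤frac n m {+ suc d} {+ suc e} _ _ nE≤mD = ℚP.toℚᵘ-cancel-≤
  (ℚᵘP.≤-respˡ-≃ (ℚᵘP.≃-sym (toℚᵘ-frac n d))
  (ℚᵘP.≤-respʳ-≃ (ℚᵘP.≃-sym (toℚᵘ-frac m e)) (ℚᵘ.*≤* nE≤mD)))

frac<frac : ∀ n m {D E} → 0ℤ ℤ.< D → 0ℤ ℤ.< E →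
            n ℤ.* E ℤ.< m ℤ.* D → frac n D <ℚ frac m E
frac<frac n m {+ zero} (+<+ ()) _ _
frac<frac n m {+ suc _} {+ zero} _ (+<+ ()) _
frac<frac n m {+ suc d} {+ suc e} _ _ nE<mD = ℚP.toℚᵘ-cancel-<
  (ℚᵘP.<-respˡ-≃ (ℚᵘP.≃-sym (toℚᵘ-frac n d))
  (ℚᵘP.<-respʳ-≃ (ℚᵘP.≃-sym (toℚᵘ-frac m e)) (ℚᵘ.*<* nE<mD)))

frac*frac : ∀ n m {D E} → 0ℤ ℤ.< D → 0ℤ ℤ.< E →
            frac n D ℚ.* frac m E ≡ frac (n ℤ.* m) (D ℤ.* E)
frac*frac n m {+ zero} (+<+ ()) _
frac*frac n m {+ suc _} {+ zero} _ (+<+ ())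
frac*frac n m {+ suc d} {+ suc e} _ _ = ℚP.toℚᵘ-injective
  (ℚᵘP.≃-trans (ℚP.toℚᵘ-homo-* (frac n (+ suc d)) (frac m (+ suc e)))
  (ℚᵘP.≃-trans (ℚᵘP.*-cong (toℚᵘ-frac n d) (toℚᵘ-frac m e))
               (ℚᵘP.≃-sym (toℚᵘ-frac (n ℤ.* m) (e + d * suc e)))))

frac-nonNeg : ∀ n {D} → 0ℤ ℤ.≤ n → 0ℤ ℤ.< D → 0ℚ ≤ℚ frac n D
frac-nonNeg n 0≤n 0<D =
  frac≤frac 0ℤ n (+<+ (s≤s z≤n)) 0<D (subst (0ℤ ℤ.≤_) (sym (ℤP.*-identityʳ n)) 0≤n)

frac-pos : ∀ n {D} → 0ℤ ℤ.< n → 0ℤ ℤ.< D → 0ℚ <ℚ frac n D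
frac-pos n 0<n 0<D =
  frac<frac 0ℤ n (+<+ (s≤s z≤n)) 0<D (subst (0ℤ ℤ.<_) (sym (ℤP.*-identityʳ n)) 0<n)

<-⊓ : ∀ {x y z} → x <ℚ y → x <ℚ z → x <ℚ y ⊓ z
<-⊓ {x} {y} {z} x<y x<z with ℚP.⊓-sel y z
... | inj₁ y⊓z≡y = subst (x <ℚ_) (sym y⊓z≡y) x<y
... | inj₂ y⊓z≡z = subst (x <ℚ_) (sym y⊓z≡z) x<z

half-open-nonempty⇔ : ∀ {l h} → (∃ λ α → l <ℚ α × α ≤ℚ h) ⇔ l <ℚ h
half-open-nonempty⇔ {l} {h} = mk⇔
  (λ (α , l<α , α≤h) → ℚP.<-≤-trans l<α α≤h)
  (λ l<h → h , l<h , ℚP.≤-refl)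

module Interval (p β q σ : ℕ) (1≤β : 1 ≤ β) (3+2β≤p : 3 + 2 * β ≤ p)
                (p≤1+β+σ : p ≤ suc (β + σ)) (1+σ<q : suc σ < q) where

  private
    2β≡β+β : 2 * β ≡ β + β
    2β≡β+β = cong (β ℕ.+_) (ℕP.+-identityʳ β)

    3+β+β≤p : 3 + (β + β) ≤ p
    3+β+β≤p = subst (λ n → 3 + n ≤ p) 2β≡β+β 3+2β≤p

    1+β+β≤p : 1 + (β + β) ≤ p
    1+β+β≤p = ℕP.≤-trans (ℕP.+-monoˡ-≤ (β + β) {1} {3} (s≤s z≤n)) 3+β+β≤p

    1+β<p : 1 + β < p
    1+β<p = ℕP.≤-trans (ℕP.+-mono-≤ {2} {3} (s≤s (s≤s z≤n)) (ℕP.m≤m+n β β)) 3+β+β≤p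

    β<p : β < p
    β<p = ℕP.<⇒≤ 1+β<p

    β≤1+σ : β ≤ suc σ
    β≤1+σ = ℕP.m≤n⇒m≤1+n (ℕP.+-cancelˡ-≤ β β σ
      (ℕP.≤-trans (ℕP.m≤n+m (β + β) 2) (ℕ.s≤s⁻¹ (ℕP.≤-trans 3+β+β≤p p≤1+β+σ))))

    P B Q G S : ℤ
    P = + p
    B = + β
    Q = + q
    G = + σ
    S = + suc σ

    0<P : 0ℤ ℤ.< P
    0<P = +<+ (ℕP.≤-trans (s≤s z≤n) β<p)

    0<B : 0ℤ ℤ.< B
    0<B = +<+ 1≤β

    0<Q : 0ℤ ℤ.< Q
    0<Q = +<+ (ℕP.≤-trans (s≤s z≤n) 1+σ<q)

    0<1 : 0ℤ ℤ.< + 1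
    0<1 = +<+ (s≤s z≤n)

    0<S : 0ℤ ℤ.< S
    0<S = +<+ (s≤s z≤n)

    0<P-B : 0ℤ ℤ.< P ℤ.- B
    0<P-B = 0<+n-+m β<p

    0<P-1-B : 0ℤ ℤ.< P ℤ.- (+ 1 ℤ.+ B)
    0<P-1-B = 0<+n-+m 1+β<p

  -- S = σ + 1 plays the role of β*. Differences are spelled so that they compute to
  -- + n - + m (e.g. + 1 ℤ.+ B is + (1 + β)); their signs then come from 0≤+n-+m.
  q/p λ₀ γ₁ γ₂ : ℚ
  q/p = frac Q P
  λ₀ = frac (P ℤ.- (+ 1 ℤ.+ (B ℤ.+ B))) (P ℤ.- (+ 1 ℤ.+ B))
  γ₁ = frac (P ℤ.- S) (P ℤ.- B)
  γ₂ = frac (S ℤ.- B) S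

  c₁ b₁ b₂ b₃ b₄ : ℚ
  c₁ = frac (P ℤ.* (B ℤ.- + 1)) (+ 1)
  b₁ = frac ((G ℤ.+ + 1) ℤ.* Q ℤ.- + 1) (+ 1)
  b₂ = frac (Q ℤ.* (P ℤ.- G ℤ.- + 1)) (P ℤ.* (P ℤ.- B))
  b₃ = frac (Q ℤ.* (G ℤ.+ + 1 ℤ.- B)) (P ℤ.* (G ℤ.+ + 1))
  b₄ = frac (Q ℤ.* (P ℤ.- + 2 ℤ.* B ℤ.- + 1)) (P ℤ.* (P ℤ.- B ℤ.- + 1))

  0<q/p : 0ℚ <ℚ q/p
  0<q/p = frac-pos Q 0<Q 0<P

  instance
    q/p-positive : ℚ.Positive q/p
    q/p-positive = ℚ.positive 0<q/p

    q/p-nonNegative : ℚ.NonNegative q/p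
    q/p-nonNegative = ℚ.nonNegative (ℚP.<⇒≤ 0<q/p)

  b₂≡q/p*γ₁ : b₂ ≡ q/p ℚ.* γ₁
  b₂≡q/p*γ₁ = trans (cong (λ n → frac n (P ℤ.* (P ℤ.- B))) (numerator Q P G))
                    (sym (frac*frac Q (P ℤ.- S) 0<P 0<P-B))
    where
    numerator : ∀ Q P G → Q ℤ.* (P ℤ.- G ℤ.- + 1) ≡ Q ℤ.* (P ℤ.- (+ 1 ℤ.+ G))
    numerator = ℤ-Solver.solve-∀

  b₃≡q/p*γ₂ : b₃ ≡ q/p ℚ.* γ₂
  b₃≡q/p*γ₂ = trans (cong₂ frac (numerator Q G B) (denominator P G))
                    (sym (frac*frac Q (S ℤ.- B) 0<P 0<S))
    where
    numerator : ∀ Q G B → Q ℤ.* (G ℤ.+ + 1 ℤ.- B) ≡ Q ℤ.* ((+ 1 ℤ.+ G) ℤ.- B)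
    numerator = ℤ-Solver.solve-∀
    denominator : ∀ P G → P ℤ.* (G ℤ.+ + 1) ≡ P ℤ.* (+ 1 ℤ.+ G)
    denominator = ℤ-Solver.solve-∀

  lowI≡q/p*λ₀ : lowI p β q ≡ q/p ℚ.* λ₀
  lowI≡q/p*λ₀ = trans (cong₂ frac (numerator Q P B) (denominator P B))
                      (sym (frac*frac Q (P ℤ.- (+ 1 ℤ.+ (B ℤ.+ B))) 0<P 0<P-1-B))
    where
    numerator : ∀ Q P B → Q ℤ.* (P ℤ.- + 1 ℤ.- + 2 ℤ.* B) ≡ Q ℤ.* (P ℤ.- (+ 1 ℤ.+ (B ℤ.+ B)))
    numerator = ℤ-Solver.solve-∀
    denominator : ∀ P B → P ℤ.* (P ℤ.- + 1 ℤ.- B) ≡ P ℤ.* (P ℤ.- (+ 1 ℤ.+ B))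
    denominator = ℤ-Solver.solve-∀

  b₄≡lowI : b₄ ≡ lowI p β q
  b₄≡lowI = cong₂ frac (numerator Q P B) (denominator P B)
    where
    numerator : ∀ Q P B → Q ℤ.* (P ℤ.- + 2 ℤ.* B ℤ.- + 1) ≡ Q ℤ.* (P ℤ.- + 1 ℤ.- + 2 ℤ.* B)
    numerator = ℤ-Solver.solve-∀
    denominator : ∀ P B → P ℤ.* (P ℤ.- B ℤ.- + 1) ≡ P ℤ.* (P ℤ.- + 1 ℤ.- B)
    denominator = ℤ-Solver.solve-∀

  highI≡b₂⊓b₃ : highI p β (suc σ) q ≡ b₂ ⊓ b₃
  highI≡b₂⊓b₃ = begin
    q/p ℚ.* (γ₁ ⊓ γ₂)           ≡⟨ ℚP.mono-≤-distrib-⊓ (ℚP.*-monoˡ-≤-nonNeg q/p) γ₁ γ₂ ⟩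
    (q/p ℚ.* γ₁) ⊓ (q/p ℚ.* γ₂) ≡⟨ cong₂ _⊓_ b₂≡q/p*γ₁ b₃≡q/p*γ₂ ⟨
    b₂ ⊓ b₃                     ∎
    where open ≡-Reasoning

  λ₀<γ₂ : λ₀ <ℚ γ₂
  λ₀<γ₂ = frac<frac (P ℤ.- (+ 1 ℤ.+ (B ℤ.+ B))) (S ℤ.- B) 0<P-1-B 0<S
    (<-from-gap (B ℤ.* ((+ 1 ℤ.+ (B ℤ.+ G)) ℤ.- P) ℤ.+ B) (cross P B G)
      (nonNeg+pos (nonNeg*nonNeg (ℤP.<⇒≤ 0<B) (0≤+n-+m p≤1+β+σ)) 0<B))
    where
    cross : ∀ P B G →
      ((+ 1 ℤ.+ G) ℤ.- B) ℤ.* (P ℤ.- (+ 1 ℤ.+ B))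
        ≡ (P ℤ.- (+ 1 ℤ.+ (B ℤ.+ B))) ℤ.* (+ 1 ℤ.+ G) ℤ.+ (B ℤ.* ((+ 1 ℤ.+ (B ℤ.+ G)) ℤ.- P) ℤ.+ B)
    cross = ℤ-Solver.solve-∀

  λ₀<γ₁ : suc σ ≤ 2 * β → λ₀ <ℚ γ₁
  λ₀<γ₁ 1+σ≤2β = frac<frac (P ℤ.- (+ 1 ℤ.+ (B ℤ.+ B))) (P ℤ.- S) 0<P-1-B 0<P-B
    (<-from-gap ((P ℤ.- (+ 1 ℤ.+ B)) ℤ.* ((B ℤ.+ B) ℤ.- S) ℤ.+ B) (cross P B G)
      (nonNeg+pos (nonNeg*nonNeg (ℤP.<⇒≤ 0<P-1-B) (0≤+n-+m (subst (suc σ ≤_) 2β≡β+β 1+σ≤2β))) 0<B))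
    where
    cross : ∀ P B G →
      (P ℤ.- (+ 1 ℤ.+ G)) ℤ.* (P ℤ.- (+ 1 ℤ.+ B))
        ≡ (P ℤ.- (+ 1 ℤ.+ (B ℤ.+ B))) ℤ.* (P ℤ.- B)
          ℤ.+ ((P ℤ.- (+ 1 ℤ.+ B)) ℤ.* ((B ℤ.+ B) ℤ.- (+ 1 ℤ.+ G)) ℤ.+ B)
    cross = ℤ-Solver.solve-∀

  γ₁≤λ₀ : 2 * β < suc σ → γ₁ ≤ℚ λ₀
  γ₁≤λ₀ 2β<1+σ = frac≤frac (P ℤ.- S) (P ℤ.- (+ 1 ℤ.+ (B ℤ.+ B))) 0<P-B 0<P-1-B
    (≤-from-gap ((P ℤ.- (+ 1 ℤ.+ B)) ℤ.* (S ℤ.- (+ 1 ℤ.+ (B ℤ.+ B))) ℤ.+ (P ℤ.- (+ 1 ℤ.+ (B ℤ.+ B))))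
                (cross P B G)
      (nonNeg+nonNeg (nonNeg*nonNeg (ℤP.<⇒≤ 0<P-1-B) (0≤+n-+m (subst (ℕ._< suc σ) 2β≡β+β 2β<1+σ)))
                     (0≤+n-+m 1+β+β≤p)))
    where
    cross : ∀ P B G →
      (P ℤ.- (+ 1 ℤ.+ (B ℤ.+ B))) ℤ.* (P ℤ.- B)
        ≡ (P ℤ.- (+ 1 ℤ.+ G)) ℤ.* (P ℤ.- (+ 1 ℤ.+ B))
          ℤ.+ ((P ℤ.- (+ 1 ℤ.+ B)) ℤ.* ((+ 1 ℤ.+ G) ℤ.- (+ 1 ℤ.+ (B ℤ.+ B)))
               ℤ.+ (P ℤ.- (+ 1 ℤ.+ (B ℤ.+ B))))
    cross = ℤ-Solver.solve-∀

  c₁*b₃<b₁ : c₁ ℚ.* b₃ <ℚ b₁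
  c₁*b₃<b₁ = subst (_<ℚ b₁) (sym (frac*frac P[B-1] Q[1+σ-B] 0<1 0<P*[1+σ]))
    (frac<frac (P[B-1] ℤ.* Q[1+σ-B]) ((G ℤ.+ + 1) ℤ.* Q ℤ.- + 1) (pos*pos 0<1 0<P*[1+σ]) 0<1
      (<-from-gap (P ℤ.* gap) (cross P B G Q) (pos*pos 0<P 0<gap)))
    where
    P[B-1] Q[1+σ-B] gap : ℤ
    P[B-1] = P ℤ.* (B ℤ.- + 1)
    Q[1+σ-B] = Q ℤ.* (G ℤ.+ + 1 ℤ.- B)
    gap = Q ℤ.* (B ℤ.- + 1) ℤ.* (B ℤ.+ + 1) ℤ.+ Q ℤ.* (S ℤ.- B) ℤ.* (+ 2 ℤ.+ G) ℤ.+ (Q ℤ.- S)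
    0<P*[1+σ] : 0ℤ ℤ.< P ℤ.* (G ℤ.+ + 1)
    0<P*[1+σ] = pos*pos 0<P (+<+ (ℕP.m≤n+m 1 σ))
    0≤Q : 0ℤ ℤ.≤ Q
    0≤Q = +≤+ z≤n
    0<gap : 0ℤ ℤ.< gap
    0<gap = nonNeg+pos
      (nonNeg+nonNeg (nonNeg*nonNeg (nonNeg*nonNeg 0≤Q (0≤+n-+m 1≤β)) (+≤+ z≤n))
                     (nonNeg*nonNeg (nonNeg*nonNeg 0≤Q (0≤+n-+m β≤1+σ)) (+≤+ z≤n)))
      (0<+n-+m 1+σ<q)
    cross : ∀ P B G Q →
      ((G ℤ.+ + 1) ℤ.* Q ℤ.- + 1) ℤ.* (+ 1 ℤ.* (P ℤ.* (G ℤ.+ + 1)))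
        ≡ (P ℤ.* (B ℤ.- + 1)) ℤ.* (Q ℤ.* (G ℤ.+ + 1 ℤ.- B)) ℤ.* + 1
          ℤ.+ P ℤ.* (Q ℤ.* (B ℤ.- + 1) ℤ.* (B ℤ.+ + 1)
                     ℤ.+ Q ℤ.* ((+ 1 ℤ.+ G) ℤ.- B) ℤ.* (+ 2 ℤ.+ G)
                     ℤ.+ (Q ℤ.- (+ 1 ℤ.+ G)))
    cross = ℤ-Solver.solve-∀

  ≤b₃⇒c₁*<b₁ : ∀ {α} → α ≤ℚ b₃ → c₁ ℚ.* α <ℚ b₁
  ≤b₃⇒c₁*<b₁ α≤b₃ = ℚP.≤-<-trans (ℚP.*-monoˡ-≤-nonNeg c₁ {{ℚ.nonNegative 0≤c₁}} α≤b₃) c₁*b₃<b₁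
    where
    0≤c₁ : 0ℚ ≤ℚ c₁
    0≤c₁ = frac-nonNeg (P ℤ.* (B ℤ.- + 1)) (nonNeg*nonNeg (ℤP.<⇒≤ 0<P) (0≤+n-+m 1≤β)) 0<1

  0≤lowI : 0ℚ ≤ℚ lowI p β q
  0≤lowI = subst (0ℚ ≤ℚ_) (sym lowI≡q/p*λ₀)
    (ℚP.nonNegative⁻¹ _ {{ℚP.nonNeg*nonNeg⇒nonNeg q/p λ₀ {{ℚ.nonNegative 0≤λ₀}}}})
    where
    0≤λ₀ : 0ℚ ≤ℚ λ₀
    0≤λ₀ = frac-nonNeg (P ℤ.- (+ 1 ℤ.+ (B ℤ.+ B))) (0≤+n-+m 1+β+β≤p) 0<P-1-B

  InI⇔ : ∀ α → InI p β q σ α ⇔ (lowI p β q <ℚ α × α ≤ℚ highI p β (suc σ) q)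
  InI⇔ α = mk⇔
    (λ (_ , α≤b₂ , α≤b₃ , b₄<α) →
       subst (_<ℚ α) b₄≡lowI b₄<α , subst (α ≤ℚ_) (sym highI≡b₂⊓b₃) (ℚP.⊓-glb α≤b₂ α≤b₃))
    (λ (lowI<α , α≤highI) →
       let α≤b₂⊓b₃ = subst (α ≤ℚ_) highI≡b₂⊓b₃ α≤highI
           α≤b₃    = ℚP.p≤q⊓r⇒p≤r b₂ b₃ α≤b₂⊓b₃
       in ≤b₃⇒c₁*<b₁ α≤b₃ , ℚP.p≤q⊓r⇒p≤q b₂ b₃ α≤b₂⊓b₃ , α≤b₃ , subst (_<ℚ α) (sym b₄≡lowI) lowI<α)

  λ₀<γ₁⊓γ₂⇔ : λ₀ <ℚ γ₁ ⊓ γ₂ ⇔ suc σ ≤ 2 * β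
  λ₀<γ₁⊓γ₂⇔ = mk⇔ λ₀<γ₁⊓γ₂⇒1+σ≤2β (λ 1+σ≤2β → <-⊓ (λ₀<γ₁ 1+σ≤2β) λ₀<γ₂)
    where
    λ₀<γ₁⊓γ₂⇒1+σ≤2β : λ₀ <ℚ γ₁ ⊓ γ₂ → suc σ ≤ 2 * β
    λ₀<γ₁⊓γ₂⇒1+σ≤2β λ₀<γ₁⊓γ₂ with suc σ ≤? 2 * β
    ... | yes 1+σ≤2β = 1+σ≤2β
    ... | no 1+σ≰2β = contradiction
      (ℚP.<-≤-trans (ℚP.<-≤-trans λ₀<γ₁⊓γ₂ (ℚP.p⊓q≤p γ₁ γ₂)) (γ₁≤λ₀ (ℕP.≰⇒> 1+σ≰2β)))
      (ℚP.<-irrefl refl)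

  lowI<highI⇔ : lowI p β q <ℚ highI p β (suc σ) q ⇔ suc σ ≤ 2 * β
  lowI<highI⇔ rewrite lowI≡q/p*λ₀ =
    ⇔.trans (mk⇔ (ℚP.*-cancelˡ-<-nonNeg q/p) (ℚP.*-monoʳ-<-pos q/p)) λ₀<γ₁⊓γ₂⇔
    where module ⇔ = Function.Properties.Equivalence

  nonempty⇔ : (∃ λ α → InI p β q σ α) ⇔ (suc σ ≤ 2 * β)
  nonempty⇔ = mk⇔
    (λ (α , α∈I) → to lowI<highI⇔ (to half-open-nonempty⇔ (α , to (InI⇔ α) α∈I)))
    (λ 1+σ≤2β → let (α , bounds) = from half-open-nonempty⇔ (from lowI<highI⇔ 1+σ≤2β)
                in α , from (InI⇔ α) bounds)
    where open Equivalence

  InI⇒0< : ∀ {α} → InI p β q σ α → 0ℚ <ℚ α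
  InI⇒0< {α} α∈I = ℚP.≤-<-trans 0≤lowI (proj₁ (Equivalence.to (InI⇔ α) α∈I))

lemma6 : (p β βs q r ρ σ : ℕ) →
  Prime p → 1 ≤ β → 2 * β ≤ p ∸ 3 →
  1 ≤ βs → βs ≤ p ∸ 1 → p ∣ β * βs ∸ 1 →
  Prime q → p < q → p ∣ q ∸ β →
  Prime r → q < r → p ∣ q * r + 1 →
  (p ∸ 1) * (q ∸ 1) ≡ ρ * p + σ * q →
  p ∸ 1 ≤ β + σ →
  ((∃ λ α → InI p β q σ α) ⇔ (βs ≤ 2 * β))
  × (βs ≤ 2 * β → (α : ℚ) → InI p β q σ α ⇔ (lowI p β q <ℚ α × α ≤ℚ highI p β βs q))
  × ((∃ λ α → InI p β q σ α) → (α : ℚ) → InI p β q σ α → 0ℚ <ℚ α)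
lemma6 p β βs q _ ρ σ _ 1≤β 2β≤p∸3 1≤βs βs≤p∸1 p∣ββs∸1 _ p<q p∣q∸β _ _ _ decomposition p∸1≤β+σ =
  case 1+σ≡βs of λ where
    refl → nonempty⇔ , (λ _ → InI⇔) , (λ _ _ → InI⇒0<)
  where
  3+2β≤p : 3 + 2 * β ≤ p
  3+2β≤p = ≤∸⇒+≤ (ℕP.≤-trans 1≤β (ℕP.m≤m+n β _)) 2β≤p∸3
  β<p : β < p
  β<p = ℕP.≤-trans (ℕP.m≤n+m (suc β) 2) (ℕP.≤-trans (ℕP.+-monoʳ-≤ 3 (ℕP.m≤m+n β _)) 3+2β≤p)
  instance
    p≢0 : NonZero p
    p≢0 = ℕ.>-nonZero (ℕP.≤-trans (s≤s z≤n) β<p)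
  βs<p : βs < p
  βs<p = ≤∸⇒+≤ 1≤βs βs≤p∸1
  1+σ≡βs : suc σ ≡ βs
  1+σ≡βs = suc-σ≡βs {ρ = ρ} 1≤β 1≤βs βs<p (ℕP.<⇒≤ (ℕP.<-trans β<p p<q)) p∣ββs∸1 p∣q∸β decomposition
  p≤1+β+σ : p ≤ suc (β + σ)
  p≤1+β+σ = ℕP.≤-trans (ℕP.m≤n+m∸n p 1) (ℕP.+-monoʳ-≤ 1 p∸1≤β+σ)
  1+σ<q : suc σ < q
  1+σ<q = subst (_< q) (sym 1+σ≡βs) (ℕP.<-trans βs<p p<q)
  open Interval p β q σ 1≤β 3+2β≤p p≤1+β+σ 1+σ<q
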